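{- Let $n\in\mathbb{N}$, $s\in\mathbb{C}\setminus\{ -1,-2,-3,\dots\}$ and $x\in\mathbb{C}$. Then \[ \sum_{k=0}^{n}\binom{s+n}{k}x^k=(1+x)^n\left[1+s\sum_{k=0}^{n-1}\frac{\binom{s+k}{k}}{k+1}\left(\frac{x}{x+1}\right)^{k+1}\right]. \]
   Context: For $z\in\mathbb{C}$ and $k\in\mathbb{N}_0$, $\binom{z}{k}=\frac{z(z-1)\cdots(z-k+1)}{k!}$ (equivalently $\frac{\Gamma(z+1)}{k!\,\Gamma(z-k+1)}$, interpreted as $0$ when $z-k+1$ is a pole of $\Gamma$). For $0\le k\le n-1$ the product $(1+x)^n\left(\frac{x}{x+1}\right)^{k+1}$ is understood as the polynomial $x^{k+1}(1+x)^{n-k-1}$, so both sides are polynomials in $x$ and the identity is meaningful for all $x\in\mathbb{C}$, including $x=-1$. -}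

module Defs where

open import Level using (Level)
open import Data.Nat using (ℕ; zero; suc; _∸_)
open import Algebra.Bundles using (CommutativeRing)

-- Generic notions over a commutative ring R (used with R playing the role of ℂ).
module Over {c ℓ : Level} (R : CommutativeRing c ℓ) where
  open CommutativeRing R

  pow : Carrier → ℕ → Carrier
  pow x zero    = 1#
  pow x (suc k) = x * pow x k

  ι : ℕ → Carrier
  ι zero    = 0#
  ι (suc m) = 1# + ι m

  sumBelow : ℕ → (ℕ → Carrier) → Carrier
  sumBelow zero    f = 0#
  sumBelow (suc n) f = sumBelow n f + f n

  fall : Carrier → ℕ → Carrier
  fall z zero    = 1#
  fall z (suc k) = fall z k * (z - ι k)

  -- Given inv m = (m+1)⁻¹, factInv inv k = (k!)⁻¹
  factInv : (ℕ → Carrier) → ℕ → Carrier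
  factInv inv zero    = 1#
  factInv inv (suc k) = factInv inv k * inv k

  binom : (ℕ → Carrier) → Carrier → ℕ → Carrier
  binom inv z k = fall z k * factInv inv k

-- Both sides satisfy the recurrence u (n+1) = (1 + x) u n + s c_n x^(n+1), with
-- c_n = binom(s+n, n)/(n+1), and both equal 1 at n = 0.  For the left side this is
-- Pascal's rule binom(z+1, k+1) = binom(z, k+1) + binom(z, k) applied to z = s + n,
-- together with binom(s+n, n+1) = s binom(s+n, n)/(n+1) for the new top coefficient;
-- for the right side it is Horner's scheme.  Everything is a polynomial identity in
-- s.
module Submission where

open import Defs
open import Data.Nat using (ℕ; zero; suc; _∸_; _<_)
open import Data.Nat.Properties using (n∸n≡0; +-∸-assoc; m<n⇒m<1+n; n<1+n)
open import Data.Maybe using (nothing)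
open import Relation.Nullary using (¬_)
import Relation.Binary.PropositionalEquality as ≡
open import Algebra.Bundles using (CommutativeRing)
open import Tactic.RingSolver.Core.AlmostCommutativeRing using (fromCommutativeRing)
import Tactic.RingSolver.NonReflective as NonReflective

module _ {c ℓ} (R : CommutativeRing c ℓ) where
  open CommutativeRing R
  open Over R
  open NonReflective (fromCommutativeRing R (λ _ → nothing)) using (solve; _⊜_; _⊕_; _⊗_)
  open import Algebra.Properties.Ring ring using (-0#≈0#)
  open import Algebra.Properties.Group +-group using (//-rightDividesˡ; //-rightDividesʳ)
  open import Algebra.Properties.CommutativeSemigroup *-commutativeSemigroup using (xy∙z≈y∙xz; x∙yz≈y∙xz)
  import Algebra.Properties.CommutativeSemigroup +-commutativeSemigroup as +-Properties
  open import Relation.Binary.Reasoning.Setoid setoid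

  [1+y]*a≈a+y*a : ∀ y a → (1# + y) * a ≈ a + y * a
  [1+y]*a≈a+y*a y a = trans (distribʳ a 1# y) (+-congʳ (*-identityˡ a))

  recurrence-unique : ∀ (y : Carrier) (t u v : ℕ → Carrier) → u 0 ≈ v 0 →
                      (∀ n → u (suc n) ≈ y * u n + t n) →
                      (∀ n → v (suc n) ≈ y * v n + t n) →
                      ∀ n → u n ≈ v n
  recurrence-unique y t u v u₀≈v₀ u-step v-step zero    = u₀≈v₀
  recurrence-unique y t u v u₀≈v₀ u-step v-step (suc n) = begin
    u (suc n)     ≈⟨ u-step n ⟩
    y * u n + t n ≈⟨ +-congʳ (*-congˡ (recurrence-unique y t u v u₀≈v₀ u-step v-step n)) ⟩
    y * v n + t n ≈⟨ v-step n ⟨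
    v (suc n)     ∎

  sumBelow-cong : ∀ n {f g : ℕ → Carrier} → (∀ k → k < n → f k ≈ g k) →
                  sumBelow n f ≈ sumBelow n g
  sumBelow-cong zero    f≈g = refl
  sumBelow-cong (suc n) f≈g =
    +-cong (sumBelow-cong n (λ k k<n → f≈g k (m<n⇒m<1+n k<n))) (f≈g n (n<1+n n))

  sumBelow-+ : ∀ n (f g : ℕ → Carrier) →
               sumBelow n (λ k → f k + g k) ≈ sumBelow n f + sumBelow n g
  sumBelow-+ zero    f g = sym (+-identityʳ 0#)
  sumBelow-+ (suc n) f g = trans (+-congʳ (sumBelow-+ n f g)) (+-interchange _ _ _ _)
    where
    +-interchange : ∀ a b c d → (a + b) + (c + d) ≈ (a + c) + (b + d)
    +-interchange = solve 4 (λ a b c d → ((a ⊕ b) ⊕ (c ⊕ d)) ⊜ ((a ⊕ c) ⊕ (b ⊕ d))) refl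

  *-distribˡ-sumBelow : ∀ n a (f : ℕ → Carrier) →
                        a * sumBelow n f ≈ sumBelow n (λ k → a * f k)
  *-distribˡ-sumBelow zero    a f = zeroʳ a
  *-distribˡ-sumBelow (suc n) a f = trans (distribˡ a _ _) (+-congʳ (*-distribˡ-sumBelow n a f))

  sumBelow-sucˡ : ∀ n (f : ℕ → Carrier) →
                  sumBelow (suc n) f ≈ f 0 + sumBelow n (λ k → f (suc k))
  sumBelow-sucˡ zero    f = +-comm 0# (f 0)
  sumBelow-sucˡ (suc n) f = trans (+-congʳ (sumBelow-sucˡ n f)) (+-assoc _ _ _)

  horner-suc : ∀ y (a : ℕ → Carrier) n →
               sumBelow (suc n) (λ k → a k * pow y (n ∸ k))
                 ≈ y * sumBelow n (λ k → a k * pow y (n ∸ suc k)) + a n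
  horner-suc y a n = +-cong (begin
      sumBelow n (λ k → a k * pow y (n ∸ k))           ≈⟨ sumBelow-cong n lower ⟩
      sumBelow n (λ k → y * (a k * pow y (n ∸ suc k))) ≈⟨ *-distribˡ-sumBelow n y _ ⟨
      y * sumBelow n (λ k → a k * pow y (n ∸ suc k))   ∎)
    (trans (*-congˡ (reflexive (≡.cong (pow y) (n∸n≡0 n)))) (*-identityʳ (a n)))
    where
    lower : ∀ k → k < n → a k * pow y (n ∸ k) ≈ y * (a k * pow y (n ∸ suc k))
    lower k k<n = trans (*-congˡ (reflexive (≡.cong (pow y) (+-∸-assoc 1 k<n))))
                        (x∙yz≈y∙xz (a k) y _)

  fall-cong : ∀ {z w} → z ≈ w → ∀ k → fall z k ≈ fall w k
  fall-cong z≈w zero    = refl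
  fall-cong z≈w (suc k) = *-cong (fall-cong z≈w k) (+-congʳ z≈w)

  fall-1+ : ∀ z k → fall (1# + z) (suc k) ≈ (1# + z) * fall z k
  fall-1+ z zero    = begin
    1# * ((1# + z) - 0#) ≈⟨ *-identityˡ _ ⟩
    (1# + z) - 0#        ≈⟨ +-congˡ -0#≈0# ⟩
    (1# + z) + 0#        ≈⟨ +-identityʳ _ ⟩
    1# + z               ≈⟨ *-identityʳ _ ⟨
    (1# + z) * 1#        ∎
  fall-1+ z (suc k) = begin
    fall (1# + z) (suc k) * ((1# + z) - (1# + ι k)) ≈⟨ *-cong (fall-1+ z k) (shift z (ι k)) ⟩
    ((1# + z) * fall z k) * (z - ι k)               ≈⟨ *-assoc _ _ _ ⟩
    (1# + z) * (fall z k * (z - ι k))               ∎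
    where
    shift : ∀ z i → (1# + z) - (1# + i) ≈ z - i
    shift z i = begin
      (1# + z) - (1# + i)             ≈⟨ +-congʳ (+-congˡ (//-rightDividesˡ i z)) ⟨
      (1# + ((z - i) + i)) - (1# + i) ≈⟨ +-congʳ (+-Properties.x∙yz≈y∙xz 1# (z - i) i) ⟩
      ((z - i) + (1# + i)) - (1# + i) ≈⟨ //-rightDividesʳ (1# + i) (z - i) ⟩
      z - i                           ∎

  module Binomial (inv : ℕ → Carrier) (inv-correct : ∀ m → ι (suc m) * inv m ≈ 1#) where

    binom-cong : ∀ {z w} → z ≈ w → ∀ k → binom inv z k ≈ binom inv w k
    binom-cong z≈w k = *-congʳ (fall-cong z≈w k)

    binom-suc : ∀ z k → binom inv z (suc k) ≈ (z - ι k) * (binom inv z k * inv k)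
    binom-suc z k = trans (xy∙z≈y∙xz (fall z k) (z - ι k) _)
                          (*-congˡ (sym (*-assoc (fall z k) (factInv inv k) (inv k))))

    binom-pascal : ∀ z k → binom inv (1# + z) (suc k) ≈ binom inv z (suc k) + binom inv z k
    binom-pascal z k = begin
      fall (1# + z) (suc k) * (F * i)        ≈⟨ *-congʳ (fall-1+ z k) ⟩
      ((1# + z) * f) * (F * i)               ≈⟨ *-congʳ (*-congʳ (+-congˡ (//-rightDividesˡ K z))) ⟨
      ((1# + (w + K)) * f) * (F * i)         ≈⟨ expand 1# w K f F i ⟩
      (f * w) * (F * i) + (f * F) * ((1# + K) * i) ≈⟨ +-congˡ (*-congˡ (inv-correct k)) ⟩
      (f * w) * (F * i) + (f * F) * 1#       ≈⟨ +-congˡ (*-identityʳ _) ⟩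
      (f * w) * (F * i) + f * F              ∎
      where
      f = fall z k
      F = factInv inv k
      i = inv k
      K = ι k
      w = z - K
      expand : ∀ o w K f F i →
               ((o + (w + K)) * f) * (F * i) ≈ (f * w) * (F * i) + (f * F) * ((o + K) * i)
      expand = solve 6 (λ o w K f F i →
        (((o ⊕ (w ⊕ K)) ⊗ f) ⊗ (F ⊗ i)) ⊜ ((f ⊗ w) ⊗ (F ⊗ i) ⊕ (f ⊗ F) ⊗ ((o ⊕ K) ⊗ i))) refl

    binomialSum : Carrier → Carrier → ℕ → Carrier
    binomialSum x z m = sumBelow (suc m) (λ k → binom inv z k * pow x k)

    binomialSum-cong : ∀ x {z w} → z ≈ w → ∀ m → binomialSum x z m ≈ binomialSum x w m
    binomialSum-cong x z≈w m = sumBelow-cong (suc m) (λ k _ → *-congʳ (binom-cong z≈w k))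

    binomialSum-1+ : ∀ x z m →
                     binomialSum x (1# + z) (suc m)
                       ≈ (1# + x) * binomialSum x z m + binom inv z (suc m) * pow x (suc m)
    binomialSum-1+ x z m = begin
      sumBelow (suc (suc m)) G                                    ≈⟨ sumBelow-sucˡ (suc m) G ⟩
      g 0 + sumBelow (suc m) (λ k → G (suc k))                    ≈⟨ +-congˡ (sumBelow-cong (suc m) (λ k _ → pascal-term k)) ⟩
      g 0 + sumBelow (suc m) (λ k → g (suc k) + x * g k)          ≈⟨ +-congˡ (sumBelow-+ (suc m) _ _) ⟩
      g 0 + (sumBelow (suc m) (λ k → g (suc k)) + sumBelow (suc m) (λ k → x * g k))
        ≈⟨ +-congˡ (+-congˡ (*-distribˡ-sumBelow (suc m) x g)) ⟨
      g 0 + (sumBelow (suc m) (λ k → g (suc k)) + x * S)          ≈⟨ +-assoc _ _ _ ⟨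
      (g 0 + sumBelow (suc m) (λ k → g (suc k))) + x * S          ≈⟨ +-congʳ (sumBelow-sucˡ (suc m) g) ⟨
      (S + g (suc m)) + x * S                                     ≈⟨ regroup S (g (suc m)) (x * S) ⟩
      (S + x * S) + g (suc m)                                     ≈⟨ +-congʳ ([1+y]*a≈a+y*a x S) ⟨
      (1# + x) * S + g (suc m)                                    ∎
      where
      g G : ℕ → Carrier
      g k = binom inv z k * pow x k
      G k = binom inv (1# + z) k * pow x k
      S = binomialSum x z m
      pascal-term : ∀ k → G (suc k) ≈ g (suc k) + x * g k
      pascal-term k = trans (*-congʳ (binom-pascal z k))
        (solve 4 (λ a b y p → ((a ⊕ b) ⊗ (y ⊗ p)) ⊜ (a ⊗ (y ⊗ p) ⊕ y ⊗ (b ⊗ p))) refl _ _ x (pow x k))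
      regroup : ∀ a b c → (a + b) + c ≈ (a + c) + b
      regroup = solve 3 (λ a b c → ((a ⊕ b) ⊕ c) ⊜ ((a ⊕ c) ⊕ b)) refl

    module Sides (s x : Carrier) where

      coeff : ℕ → Carrier
      coeff k = binom inv (s + ι k) k * inv k

      newTerm : ℕ → Carrier
      newTerm n = s * (coeff n * pow x (suc n))

      lhs rhs : ℕ → Carrier
      lhs n = binomialSum x (s + ι n) n
      rhs n = pow (1# + x) n
              + s * sumBelow n (λ k → coeff k * (pow x (suc k) * pow (1# + x) (n ∸ suc k)))

      lhs≈rhs-zero : lhs 0 ≈ rhs 0
      lhs≈rhs-zero = begin
        0# + (1# * 1#) * 1# ≈⟨ +-identityˡ _ ⟩
        (1# * 1#) * 1#      ≈⟨ *-identityʳ _ ⟩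
        1# * 1#             ≈⟨ *-identityʳ _ ⟩
        1#                  ≈⟨ +-identityʳ 1# ⟨
        1# + 0#             ≈⟨ +-congˡ (zeroʳ s) ⟨
        1# + s * 0#         ∎

      lhs-suc : ∀ n → lhs (suc n) ≈ (1# + x) * lhs n + newTerm n
      lhs-suc n = begin
        binomialSum x (s + (1# + ι n)) (suc n)     ≈⟨ binomialSum-cong x (+-Properties.x∙yz≈y∙xz s 1# (ι n)) (suc n) ⟩
        binomialSum x (1# + (s + ι n)) (suc n)     ≈⟨ binomialSum-1+ x (s + ι n) n ⟩
        (1# + x) * lhs n + binom inv z (suc n) * X ≈⟨ +-congˡ (*-congʳ (binom-suc z n)) ⟩
        (1# + x) * lhs n + (z - ι n) * coeff n * X ≈⟨ +-congˡ (*-congʳ (*-congʳ (//-rightDividesʳ (ι n) s))) ⟩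
        (1# + x) * lhs n + s * coeff n * X         ≈⟨ +-congˡ (*-assoc s (coeff n) X) ⟩
        (1# + x) * lhs n + newTerm n               ∎
        where
        z = s + ι n
        X = pow x (suc n)

      rhs-suc : ∀ n → rhs (suc n) ≈ (1# + x) * rhs n + newTerm n
      rhs-suc n = begin
        P * pow P n + s * sumBelow (suc n) (λ k → coeff k * (X k * pow P (n ∸ k)))
          ≈⟨ +-congˡ (*-congˡ (reassociate (suc n) (λ k → n ∸ k))) ⟩
        P * pow P n + s * sumBelow (suc n) (λ k → a k * pow P (n ∸ k))
          ≈⟨ +-congˡ (*-congˡ (horner-suc P a n)) ⟩
        P * pow P n + s * (P * sumBelow n (λ k → a k * pow P (n ∸ suc k)) + a n)
          ≈⟨ +-congˡ (*-congˡ (+-congʳ (*-congˡ (reassociate n (λ k → n ∸ suc k))))) ⟨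
        P * pow P n + s * (P * H + a n)
          ≈⟨ regroup P (pow P n) s H (a n) ⟩
        P * rhs n + s * a n ∎
        where
        P = 1# + x
        X : ℕ → Carrier
        X k = pow x (suc k)
        a : ℕ → Carrier
        a k = coeff k * X k
        H = sumBelow n (λ k → coeff k * (X k * pow P (n ∸ suc k)))
        reassociate : ∀ m (e : ℕ → ℕ) →
                      sumBelow m (λ k → coeff k * (X k * pow P (e k))) ≈ sumBelow m (λ k → a k * pow P (e k))
        reassociate m e = sumBelow-cong m (λ k _ → sym (*-assoc (coeff k) (X k) _))
        regroup : ∀ P Q s H A → P * Q + s * (P * H + A) ≈ P * (Q + s * H) + s * A
        regroup = solve 5 (λ P Q s H A → (P ⊗ Q ⊕ s ⊗ (P ⊗ H ⊕ A)) ⊜ (P ⊗ (Q ⊕ s ⊗ H) ⊕ s ⊗ A)) refl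

theorem2p1 : ∀ {c ℓ} (R : CommutativeRing c ℓ) →
    let open CommutativeRing R renaming (_+_ to _⊕_) in
    let open Over R in
    (inv : ℕ → Carrier) → (∀ m → ι (suc m) * inv m ≈ 1#) →
    (n : ℕ) (s x : Carrier) → (∀ m → ¬ (s ≈ - ι (suc m))) →
    sumBelow (suc n) (λ k → binom inv (s ⊕ ι n) k * pow x k)
      ≈ pow (1# ⊕ x) n
        ⊕ s * sumBelow n (λ k → (binom inv (s ⊕ ι k) k * inv k)
                                 * (pow x (suc k) * pow (1# ⊕ x) (n ∸ suc k)))
theorem2p1 R inv inv-correct n s x _ =
  recurrence-unique R (1# + x) newTerm lhs rhs lhs≈rhs-zero lhs-suc rhs-suc n
  where
  open CommutativeRing R using (1#; _+_)
  open Binomial R inv inv-correct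
  open Sides s x
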